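{- Let $U$ be a finite set and $\mu$ a closure operator on $2^U$. Let $\mu|_{Ky\,\mu}=\{(K,K\mu): K\in Ky\,\mu\}$ be the restriction of $\mu$ to its keys. Then $(\mu|_{Ky\,\mu})^+=\mu$.
   Context: A closure operator on $2^U$ is a map $\mu:2^U\to2^U$, written $X\mapsto X\mu$, with $X\subseteq X\mu$, $X\subseteq Y\Rightarrow X\mu\subseteq Y\mu$, and $X\mu\mu=X\mu$. A set $K\subseteq U$ is a key of $\mu$ if no proper subset $K'\subsetneq K$ satisfies $K'\mu=K\mu$; $Ky\,\mu$ is the set of keys. Extension by closure: for a function $\alpha$ (set of pairs $(S,T)$ of subsets of $U$, at most one pair per $S$) and $X\subseteq U$, put $X\alpha_0=X$, $X\alpha_{t+1}=X\alpha_t\cup\bigcup\{T:(S,T)\in\alpha,\ S\subseteq X\alpha_t\}$; the sequence stabilizes and $X\alpha^+$ is its final value; $\alpha^+$ is the map $X\mapsto X\alpha^+$. -}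

module Defs where

open import Data.Nat using (ℕ; zero; suc)
open import Data.Bool using (Bool; true; false; if_then_else_)
open import Data.Vec using (Vec; []; _∷_)
open import Data.List using (List; []; _∷_; map; _++_; filter; concatMap)
open import Data.Product using (_×_; _,_; proj₁; proj₂; ∃)
open import Data.Fin.Subset using (Subset; _⊆_; _⊂_; _∪_; ⋃; inside; outside)
open import Data.Fin.Subset.Properties using (_⊆?_)
open import Relation.Binary.PropositionalEquality using (_≡_)
open import Relation.Nullary using (¬_; Dec; yes; no)
open import Relation.Nullary.Decidable using (⌊_⌋)

-- The universe U is Fin n; 2^U is Subset n.

record IsClosure {n : ℕ} (μ : Subset n → Subset n) : Set where
  field
    extensive  : ∀ X → X ⊆ μ X
    monotone   : ∀ {X Y} → X ⊆ Y → μ X ⊆ μ Y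
    idempotent : ∀ X → μ (μ X) ≡ μ X

IsKey : {n : ℕ} → (Subset n → Subset n) → Subset n → Set
IsKey μ K = ∀ K' → K' ⊂ K → ¬ (μ K' ≡ μ K)

allSubsets : (n : ℕ) → List (Subset n)
allSubsets zero = [] ∷ []
allSubsets (suc n) = map (outside ∷_) (allSubsets n) ++ map (inside ∷_) (allSubsets n)

-- a "function" α is a finite set of pairs (S , T) (at most one pair per S)
Func : ℕ → Set
Func n = List (Subset n × Subset n)

step : {n : ℕ} → Func n → Subset n → Subset n
step α X = X ∪ ⋃ (map proj₂ (filter (λ p → proj₁ p ⊆? X) α))

iter : {n : ℕ} → Func n → ℕ → Subset n → Subset n
iter α zero X = X
iter α (suc t) X = step α (iter α t X)

IsExtClosure : {n : ℕ} → Func n → Subset n → Subset n → Set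
IsExtClosure α X Y = ∃ λ t → iter α t X ≡ Y × iter α (suc t) X ≡ Y

-- the restriction μ|_{Ky μ} = { (K , K μ) : K ∈ Ky μ }, given a decision
-- procedure for being a key (keys are decidable since U is finite)
restrictToKeys : {n : ℕ} (μ : Subset n → Subset n) →
                 (∀ K → Dec (IsKey μ K)) → Func n
restrictToKeys {n} μ key? =
  map (λ K → K , μ K) (filter key? (allSubsets n))

{-# OPTIONS --safe #-}
module Submission where

-- Every X contains a key K with K μ = X μ (descend along ⊂ while the closure is
-- preserved), and the pair (K , K μ) then fires in the first step, giving
-- X μ ⊆ X α₁; conversely every fired pair (K , K μ) has K ⊆ X, so K μ ⊆ X μ.
-- Hence X α₁ = X μ, and idempotency of μ makes the sequence stable from t = 1.

open import Defs
open import Data.Nat using (ℕ)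
open import Data.Bool.Properties using () renaming (_≟_ to _≟ᵇ_)
open import Data.Vec using ([]; _∷_)
open import Data.Vec.Properties using (≡-dec)
open import Data.Fin.Subset using (Subset; _⊆_; _⊂_; _∪_; ⋃; inside; outside)
open import Data.Fin.Subset.Properties
  using (_⊆?_; _⊂?_; ⊥⊆; ⊆-refl; ⊆-trans; ⊆-antisym; ⊆-reflexive; p⊆p∪q; q⊆p∪q; x∈p∪q⁻)
open import Data.Fin.Subset.Induction using (⊂-wellFounded; Acc; acc)
open import Data.List using (List; []; _∷_; map; filter)
open import Data.List.Relation.Unary.Any using (here; there; any?)
open import Data.List.Membership.Propositional using (_∈_; find; lose)
open import Data.List.Membership.Propositional.Properties
  using (∈-map⁺; ∈-map⁻; ∈-filter⁺; ∈-filter⁻; ∈-++⁺ˡ; ∈-++⁺ʳ)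
open import Data.Product using (_×_; _,_; proj₁; proj₂; ∃)
open import Data.Sum using (inj₁; inj₂)
open import Relation.Nullary using (Dec; yes; no)
open import Relation.Nullary.Decidable using (_×-dec_)
open import Relation.Binary.PropositionalEquality using (_≡_; refl; sym; trans; cong; module ≡-Reasoning)

private
  variable
    n : ℕ

∈-allSubsets : (X : Subset n) → X ∈ allSubsets n
∈-allSubsets []            = here refl
∈-allSubsets (outside ∷ X) = ∈-++⁺ˡ (∈-map⁺ (outside ∷_) (∈-allSubsets X))
∈-allSubsets (inside ∷ X)  =
  ∈-++⁺ʳ (map (outside ∷_) (allSubsets _)) (∈-map⁺ (inside ∷_) (∈-allSubsets X))

∪-least : {p q r : Subset n} → p ⊆ r → q ⊆ r → p ∪ q ⊆ r
∪-least {p = p} {q} p⊆r q⊆r x∈p∪q with x∈p∪q⁻ p q x∈p∪q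
... | inj₁ x∈p = p⊆r x∈p
... | inj₂ x∈q = q⊆r x∈q

∈⇒⊆⋃ : {T : Subset n} (Ts : List (Subset n)) → T ∈ Ts → T ⊆ ⋃ Ts
∈⇒⊆⋃ (T ∷ Ts) (here refl) = p⊆p∪q (⋃ Ts)
∈⇒⊆⋃ (T ∷ Ts) (there T∈Ts) = ⊆-trans (∈⇒⊆⋃ Ts T∈Ts) (q⊆p∪q T (⋃ Ts))

⋃-least : {Z : Subset n} (Ts : List (Subset n)) → (∀ {T} → T ∈ Ts → T ⊆ Z) → ⋃ Ts ⊆ Z
⋃-least []       _    = ⊥⊆
⋃-least (T ∷ Ts) Ts⊆Z = ∪-least (Ts⊆Z (here refl)) (⋃-least Ts (λ T∈Ts → Ts⊆Z (there T∈Ts)))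

step-⊆ : (α : Func n) (X Z : Subset n) → X ⊆ Z →
         (∀ {S T} → (S , T) ∈ α → S ⊆ X → T ⊆ Z) → step α X ⊆ Z
step-⊆ α X Z X⊆Z α⊆Z = ∪-least X⊆Z (⋃-least _ fired⊆Z)
  where
  fired⊆Z : ∀ {T} → T ∈ map proj₂ (filter (λ p → proj₁ p ⊆? X) α) → T ⊆ Z
  fired⊆Z T∈ with ∈-map⁻ proj₂ T∈
  ... | (S , T) , p∈ , refl with ∈-filter⁻ (λ p → proj₁ p ⊆? X) {xs = α} p∈
  ...   | p∈α , S⊆X = α⊆Z p∈α S⊆X

⊆-step : (α : Func n) (X : Subset n) {S T : Subset n} → (S , T) ∈ α → S ⊆ X → T ⊆ step α X
⊆-step α X p∈α S⊆X =
  ⊆-trans (∈⇒⊆⋃ _ (∈-map⁺ proj₂ (∈-filter⁺ (λ p → proj₁ p ⊆? X) p∈α S⊆X))) (q⊆p∪q X _)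

_≟ˢ_ : (X Y : Subset n) → Dec (X ≡ Y)
_≟ˢ_ = ≡-dec _≟ᵇ_

key-within : (μ : Subset n → Subset n) (Y : Subset n) → ∃ λ K → K ⊆ Y × μ K ≡ μ Y × IsKey μ K
key-within {n} μ Y = go Y (⊂-wellFounded Y)
  where
  go : ∀ Y → Acc _⊂_ Y → ∃ λ K → K ⊆ Y × μ K ≡ μ Y × IsKey μ K
  go Y (acc rec)
    with any? (λ K′ → (K′ ⊂? Y) ×-dec (μ K′ ≟ˢ μ Y)) (allSubsets n)
  ... | no noSmaller =
    Y , ⊆-refl , refl , λ K′ K′⊂Y eq → noSmaller (lose (∈-allSubsets K′) (K′⊂Y , eq))
  ... | yes smaller with find smaller
  ...   | K′ , _ , K′⊂Y , eq with go K′ (rec K′⊂Y)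
  ...     | K , K⊆K′ , eq′ , key = K , ⊆-trans K⊆K′ (proj₁ K′⊂Y) , trans eq′ eq , key

module _ {μ : Subset n → Subset n} (closure : IsClosure μ) (key? : ∀ K → Dec (IsKey μ K)) where
  open IsClosure closure

  private
    α : Func n
    α = restrictToKeys μ key?

  ∈-restrictToKeys : ∀ {K} → IsKey μ K → (K , μ K) ∈ α
  ∈-restrictToKeys {K} key = ∈-map⁺ (λ K → K , μ K) (∈-filter⁺ key? (∈-allSubsets K) key)

  ∈-restrictToKeys⁻ : ∀ {S T} → (S , T) ∈ α → T ≡ μ S
  ∈-restrictToKeys⁻ p∈α with ∈-map⁻ (λ K → K , μ K) p∈α
  ... | _ , _ , refl = refl

  step-restrictToKeys : ∀ X → step α X ≡ μ X
  step-restrictToKeys X = ⊆-antisym (step-⊆ α X (μ X) (extensive X) fired⊆μX) μX⊆step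
    where
    fired⊆μX : ∀ {S T} → (S , T) ∈ α → S ⊆ X → T ⊆ μ X
    fired⊆μX p∈α S⊆X rewrite ∈-restrictToKeys⁻ p∈α = monotone S⊆X

    μX⊆step : μ X ⊆ step α X
    μX⊆step with key-within μ X
    ... | K , K⊆X , μK≡μX , key =
      ⊆-trans (⊆-reflexive (sym μK≡μX)) (⊆-step α X (∈-restrictToKeys key) K⊆X)

mainTheorem6 : (n : ℕ) (μ : Subset n → Subset n) → IsClosure μ →
               (key? : ∀ K → Dec (IsKey μ K)) →
               ∀ X → IsExtClosure (restrictToKeys μ key?) X (μ X)
mainTheorem6 n μ closure key? X = 1 , μ-in-one-step , stable
  where
  open ≡-Reasoning

  α : Func n
  α = restrictToKeys μ key?

  μ-in-one-step : step α X ≡ μ X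
  μ-in-one-step = step-restrictToKeys closure key? X

  stable : step α (step α X) ≡ μ X
  stable = begin
    step α (step α X) ≡⟨ cong (step α) μ-in-one-step ⟩
    step α (μ X)      ≡⟨ step-restrictToKeys closure key? (μ X) ⟩
    μ (μ X)           ≡⟨ IsClosure.idempotent closure X ⟩
    μ X               ∎
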